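{- Let $\ell,k,c\in\mathbb{N}$ with $1\le c\le\frac{k}{\ell(\ell+1)}$, $\ell\ge3$ odd and $\ell$ dividing $k$. For $i=1,2$ let $H_i$ be a complete bipartite graph with parts $A_i,B_i$, where $|A_i|=(\ell-1)(\frac{k}{\ell}-1)$ and $|B_i|=\frac k2+\frac{(c-1)(\ell+1)}{2}-1$, with $H_1,H_2$ vertex-disjoint. Let $H_{k,\ell,c}$ be obtained from $H_1\cup H_2$ by adding a new vertex $x$ adjacent to all vertices of $A_1\cup A_2$. Let $T_{k,\ell}$ be the tree consisting of $\ell$ vertex-disjoint stars, each with $\frac{k}{\ell}$ vertices, together with an additional vertex $v$ adjacent to the centres of all these stars. Then $T_{k,\ell}$ is not (isomorphic to) a subgraph of $H_{k,\ell,c}$. -}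

module Defs where

open import Level using (0ℓ)
open import Data.Nat using (ℕ; zero; suc; _+_; _*_; _∸_; _/_)
open import Data.Fin as Fin using (Fin)
open import Data.Unit using (⊤; tt)
open import Data.Sum using (_⊎_; inj₁; inj₂)
open import Data.Product using (_×_; _,_; Σ)
open import Relation.Binary.PropositionalEquality using (_≡_)

record Graph : Set₁ where
  field
    V   : Set
    Adj : V → V → Set

open Graph public

_⊆G_ : Graph → Graph → Set
G ⊆G H = Σ (V G → V H) λ f →
           (∀ u w → f u ≡ f w → u ≡ w) ×
           (∀ u w → Adj G u w → Adj H (f u) (f w))

-- H_{k,ℓ,c}: two disjoint complete bipartite graphs K_{a,b}
-- (copies indexed by i : Fin 2, parts A = Fin a, B = Fin b)
-- plus a vertex x adjacent to all of A_1 ∪ A_2.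

HV : ℕ → ℕ → Set
HV a b = ⊤ ⊎ (Fin 2 × (Fin a ⊎ Fin b))

data HAdj (a b : ℕ) : HV a b → HV a b → Set where
  AB  : ∀ i p q → HAdj a b (inj₂ (i , inj₁ p)) (inj₂ (i , inj₂ q))
  BA  : ∀ i p q → HAdj a b (inj₂ (i , inj₂ q)) (inj₂ (i , inj₁ p))
  xA  : ∀ i p → HAdj a b (inj₁ tt) (inj₂ (i , inj₁ p))
  Ax  : ∀ i p → HAdj a b (inj₂ (i , inj₁ p)) (inj₁ tt)

Hgraph : ℕ → ℕ → Graph
Hgraph a b = record { V = HV a b ; Adj = HAdj a b }

-- |A_i| = (ℓ-1)(k/ℓ - 1), where m = k/ℓ
sizeA : ℕ → ℕ → ℕ
sizeA ℓ m = (ℓ ∸ 1) * (m ∸ 1)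

-- |B_i| = k/2 + (c-1)(ℓ+1)/2 - 1   (/ is floor division on ℕ)
sizeB : ℕ → ℕ → ℕ → ℕ
sizeB k ℓ c = k / 2 + ((c ∸ 1) * (ℓ + 1)) / 2 ∸ 1

-- H_{k,ℓ,c}, with m = k/ℓ passed explicitly
H : ℕ → ℕ → ℕ → ℕ → Graph
H k ℓ c m = Hgraph (sizeA ℓ m) (sizeB k ℓ c)

-- T_{k,ℓ}: ℓ disjoint stars with m = k/ℓ vertices each (star s has
-- vertices (s , j), j : Fin m, centre (s , zero)), plus a vertex v
-- adjacent to all centres.

TV : ℕ → ℕ → Set
TV ℓ m = ⊤ ⊎ (Fin ℓ × Fin m)

data TAdj (ℓ : ℕ) : (m : ℕ) → TV ℓ m → TV ℓ m → Set where
  vc : ∀ {n} s → TAdj ℓ (suc n) (inj₁ tt) (inj₂ (s , Fin.zero))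
  cv : ∀ {n} s → TAdj ℓ (suc n) (inj₂ (s , Fin.zero)) (inj₁ tt)
  cl : ∀ {n} s (j : Fin n) → TAdj ℓ (suc n) (inj₂ (s , Fin.zero)) (inj₂ (s , Fin.suc j))
  lc : ∀ {n} s (j : Fin n) → TAdj ℓ (suc n) (inj₂ (s , Fin.suc j)) (inj₂ (s , Fin.zero))

T : ℕ → ℕ → Graph
T ℓ m = record { V = TV ℓ m ; Adj = TAdj ℓ m }

module Submission where

-- Suppose f embeds T = T_{k,ℓ} (root v, ℓ stars with q = k/ℓ - 1
-- leaves each) into H = H_{k,ℓ,c}, whose parts have sizes a = |A_i| = (ℓ-1)q
-- and b = |B_i|.  We split according to where the root v lands.
--   * v ↦ x: every centre lies in some A_i and its q leaves in B_i.  Since ℓ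
--     is odd, one side i receives at least (ℓ+1)/2 stars, so (ℓ+1)q ≤ 2b.
--   * v ↦ A_i: the centres lie in B_i ∪ {x}, at most one of them on x; the
--     leaves of the other ≥ ℓ-1 stars, together with v, lie in A_i, so
--     (ℓ-1)q < a, which is absurd.
--   * v ↦ B_i: the centres lie in A_i, so the ℓq leaves lie in B_i ∪ {x};
--     all but at most one of them, together with v, lie in B_i, so ℓq ≤ b.
-- The hypothesis c ℓ(ℓ+1) ≤ k makes B_i small: 2b < (ℓ+1)q ≤ 2ℓq, which
-- rules out the first and third cases.

open import Defs
open import Data.Nat using (ℕ; zero; suc; _+_; _*_; _∸_; _/_; _≤_; _<_; z≤n; s≤s; s≤s⁻¹; _≤?_)
open import Data.Nat.Properties hiding (suc-injective)
open import Data.Nat.DivMod using (m/n*n≤m)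
open import Data.Nat.Divisibility using (_∣_; divides)
open import Data.Nat.Tactic.RingSolver using (solve-∀)
open import Data.Fin as Fin using (Fin; zero; suc; remQuot; combine; lift)
open import Data.Fin.Properties using (injective⇒≤; lift-injective; combine-remQuot; suc-injective)
open import Data.Vec.Functional using (_∷_)
open import Data.Unit using (tt)
open import Data.Sum using (_⊎_; inj₁; inj₂; [_,_])
open import Data.Product using (_×_; _,_; ∃; ∃₂; proj₁; proj₂; uncurry)
open import Function using (_∘_; id)
open import Function.Definitions using (Injective)
open import Relation.Nullary using (¬_; Dec; yes; no; contradiction)
open import Relation.Binary.PropositionalEquality hiding ([_])

open ≤-Reasoning

count-into : ∀ {Y : Set} {N b} (emb : Fin b → Y) (g : Fin N → Y) →
             Injective _≡_ _≡_ g → (∀ t → ∃ λ p → g t ≡ emb p) → N ≤ b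
count-into {N = N} {b} emb g g-inj lands = injective⇒≤ {f = index} index-inj
  where
  index : Fin N → Fin b
  index t = proj₁ (lands t)
  index-inj : Injective _≡_ _≡_ index
  index-inj {x} {y} same =
    g-inj (trans (proj₂ (lands x)) (trans (cong emb same) (sym (proj₂ (lands y)))))

constant-injective≤1 : ∀ {Y : Set} {r} (g : Fin r → Y) → Injective _≡_ _≡_ g →
                       (z : Y) → (∀ u → g u ≡ z) → r ≤ 1
constant-injective≤1 {r = zero}        g g-inj z const = z≤n
constant-injective≤1 {r = suc zero}    g g-inj z const = s≤s z≤n
constant-injective≤1 {r = suc (suc r)} g g-inj z const
  with g-inj {zero} {suc zero} (trans (const zero) (sym (const (suc zero))))
... | ()

cons-injective : ∀ {Y : Set} {N} (y : Y) (g : Fin N → Y) → Injective _≡_ _≡_ g →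
                 (∀ t → g t ≢ y) → Injective _≡_ _≡_ (y ∷ g)
cons-injective y g g-inj fresh {zero}  {zero}  _  = refl
cons-injective y g g-inj fresh {zero}  {suc t} eq = contradiction (sym eq) (fresh t)
cons-injective y g g-inj fresh {suc t} {zero}  eq = contradiction eq (fresh t)
cons-injective y g g-inj fresh {suc s} {suc t} eq = cong suc (g-inj eq)

remQuot-injective : ∀ {r} q → Injective _≡_ _≡_ (remQuot {r} q)
remQuot-injective {r} q {t} {t'} eq =
  trans (sym (combine-remQuot {r} q t))
        (trans (cong (uncurry combine) eq) (combine-remQuot {r} q t'))

record Partition {n} (P : Fin n → Set) : Set where
  field
    yes-size no-size : ℕ
    yes-elt  : Fin yes-size → Fin n
    no-elt   : Fin no-size → Fin n
    yes-inj  : Injective _≡_ _≡_ yes-elt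
    no-inj   : Injective _≡_ _≡_ no-elt
    yes-sat  : ∀ u → P (yes-elt u)
    no-sat   : ∀ u → ¬ P (no-elt u)
    sizes    : yes-size + no-size ≡ n

partition : ∀ {n} (P : Fin n → Set) → (∀ s → Dec (P s)) → Partition P
partition {zero} P P? = record
  { yes-size = 0 ; no-size = 0 ; yes-elt = λ () ; no-elt = λ ()
  ; yes-inj = λ {} ; no-inj = λ {} ; yes-sat = λ () ; no-sat = λ () ; sizes = refl }
partition {suc n} P P? with P? zero
... | yes p = record
  { yes-size = suc yes-size ; no-size = no-size
  ; yes-elt = lift 1 yes-elt ; no-elt = suc ∘ no-elt
  ; yes-inj = lift-injective yes-elt yes-inj 1 ; no-inj = no-inj ∘ suc-injective
  ; yes-sat = λ { zero → p ; (suc u) → yes-sat u } ; no-sat = no-sat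
  ; sizes = cong suc sizes }
  where open Partition (partition (P ∘ suc) (P? ∘ suc))
... | no ¬p = record
  { yes-size = yes-size ; no-size = suc no-size
  ; yes-elt = suc ∘ yes-elt ; no-elt = lift 1 no-elt
  ; yes-inj = yes-inj ∘ suc-injective ; no-inj = lift-injective no-elt no-inj 1
  ; yes-sat = yes-sat ; no-sat = λ { zero → ¬p ; (suc u) → no-sat u }
  ; sizes = trans (+-suc yes-size no-size) (cong suc sizes) }
  where open Partition (partition (P ∘ suc) (P? ∘ suc))

record AllButOne {n} (P : Fin n → Set) : Set where
  field
    size     : ℕ
    elt      : Fin size → Fin n
    elt-inj  : Injective _≡_ _≡_ elt
    elt-sat  : ∀ u → P (elt u)
    nearly-n : n ≤ suc size

avoid-point : ∀ {Y : Set} {n} (g : Fin n → Y) → Injective _≡_ _≡_ g → (z : Y) →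
              (∀ y → Dec (y ≡ z)) → AllButOne (λ t → g t ≢ z)
avoid-point {n = n} g g-inj z z? = record
  { size = no-size ; elt = no-elt ; elt-inj = no-inj ; elt-sat = no-sat
  ; nearly-n = begin
      n                  ≡⟨ sym sizes ⟩
      yes-size + no-size ≤⟨ +-monoˡ-≤ no-size at-most-one ⟩
      suc no-size        ∎ }
  where
  open Partition (partition (λ t → g t ≡ z) (λ t → z? (g t)))
  at-most-one : yes-size ≤ 1
  at-most-one = constant-injective≤1 (g ∘ yes-elt) (yes-inj ∘ g-inj) z yes-sat

pattern hub      = inj₁ tt
pattern vA i p   = inj₂ (i , inj₁ p)
pattern vB i p   = inj₂ (i , inj₂ p)

pattern root     = inj₁ tt
pattern centre s = inj₂ (s , zero)
pattern leaf s j = inj₂ (s , suc j)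

hub-neighbour : ∀ {a b y} → HAdj a b hub y → ∃₂ λ i p → y ≡ vA i p
hub-neighbour (xA i p) = i , p , refl

A-neighbour : ∀ {a b i p y} → HAdj a b (vA i p) y → y ≢ hub → ∃ λ p' → y ≡ vB i p'
A-neighbour (AB i p q) _    = q , refl
A-neighbour (Ax i p)   y≢hub = contradiction refl y≢hub

B-neighbour : ∀ {a b i p y} → HAdj a b (vB i p) y → ∃ λ p' → y ≡ vA i p'
B-neighbour (BA i p q) = p , refl

is-hub? : ∀ {a b} (y : HV a b) → Dec (y ≡ hub)
is-hub? hub        = yes refl
is-hub? (inj₂ _)   = no λ ()

other-side : (i : Fin 2) → i ≢ zero → i ≡ suc zero
other-side zero       i≢0 = contradiction refl i≢0
other-side (suc zero) _   = refl

centre-injective : ∀ {ℓ q} {s s' : Fin ℓ} →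
                   _≡_ {A = TV ℓ (suc q)} (centre s) (centre s') → s ≡ s'
centre-injective refl = refl

leaf-injective : ∀ {ℓ q} {s s' : Fin ℓ} {j j' : Fin q} →
                 _≡_ {A = TV ℓ (suc q)} (leaf s j) (leaf s' j') → s ≡ s' × j ≡ j'
leaf-injective refl = refl , refl

leaves : ∀ {ℓ r} q → (Fin r → Fin ℓ) → Fin (r * q) → TV ℓ (suc q)
leaves {r = r} q e t = leaf (e (proj₁ (remQuot {r} q t))) (proj₂ (remQuot {r} q t))

leaves-injective : ∀ {ℓ r} q (e : Fin r → Fin ℓ) → Injective _≡_ _≡_ e →
                   Injective _≡_ _≡_ (leaves q e)
leaves-injective {r = r} q e e-inj {t} {t'} eq with leaf-injective eq
... | same-star , same-index = remQuot-injective {r} q (cong₂ _,_ (e-inj same-star) same-index)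

Outcome : ℕ → ℕ → ℕ → ℕ → Set
Outcome ℓ q a b =
  (∃₂ λ r r' → r + r' ≡ ℓ × r * q ≤ b × r' * q ≤ b) ⊎ ((ℓ ∸ 1) * q < a) ⊎ (ℓ * q ≤ b)

module Embedding {ℓ q a b : ℕ} (f : TV ℓ (suc q) → HV a b)
                 (f-inj : ∀ u w → f u ≡ f w → u ≡ w)
                 (f-adj : ∀ u w → TAdj ℓ (suc q) u w → HAdj a b (f u) (f w)) where

  f-injective : Injective _≡_ _≡_ f
  f-injective = f-inj _ _

  image-injective : ∀ {N} (g : Fin N → TV ℓ (suc q)) → Injective _≡_ _≡_ g →
                    Injective _≡_ _≡_ (f ∘ g)
  image-injective g g-inj = g-inj ∘ f-injective

  root-adj : ∀ {y} → f root ≡ y → ∀ s → HAdj a b y (f (centre s))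
  root-adj eq s = subst (λ y → HAdj a b y (f (centre s))) eq (f-adj _ _ (vc s))

  centre-adj : ∀ {s y} → f (centre s) ≡ y → ∀ j → HAdj a b y (f (leaf s j))
  centre-adj {s} eq j = subst (λ y → HAdj a b y (f (leaf s j))) eq (f-adj _ _ (cl s j))

  module RootOnHub (root↦hub : f root ≡ hub) where
    centre-in-A : ∀ s → ∃₂ λ i p → f (centre s) ≡ vA i p
    centre-in-A s = hub-neighbour (root-adj root↦hub s)

    -- the side i with f(centre s) ∈ A_i; the leaves of s then lie in B_i,
    -- since their only other possible image x is taken by v
    side : Fin ℓ → Fin 2
    side s = proj₁ (centre-in-A s)

    leaf-in-B : ∀ s j → ∃ λ p → f (leaf s j) ≡ vB (side s) p
    leaf-in-B s j = A-neighbour (centre-adj (proj₂ (proj₂ (centre-in-A s))) j)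
                                (λ eq → leaf≢root (f-injective (trans eq (sym root↦hub))))
      where
      leaf≢root : leaf s j ≢ root
      leaf≢root ()

    side-capacity : ∀ i {r} (e : Fin r → Fin ℓ) → Injective _≡_ _≡_ e →
                    (∀ u → side (e u) ≡ i) → r * q ≤ b
    side-capacity i {r} e e-inj on-i =
      count-into (vB i) (f ∘ leaves q e) (image-injective _ (leaves-injective q e e-inj)) lands
      where
      lands : ∀ t → ∃ λ p → f (leaves q e t) ≡ vB i p
      lands t with leaf-in-B (e (proj₁ (remQuot {r} q t))) (proj₂ (remQuot {r} q t))
      ... | p , eq = p , trans eq (cong (λ i' → vB i' p) (on-i _))

    split : ∃₂ λ r r' → r + r' ≡ ℓ × r * q ≤ b × r' * q ≤ b
    split = yes-size , no-size , sizes
          , side-capacity zero yes-elt yes-inj yes-sat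
          , side-capacity (suc zero) no-elt no-inj (λ u → other-side _ (no-sat u))
      where open Partition (partition (λ s → side s ≡ zero) (λ s → side s Fin.≟ zero))

  module RootInA (i : Fin 2) (p : Fin a) (root↦A : f root ≡ vA i p) where
    open AllButOne (avoid-point (f ∘ centre) (centre-injective ∘ f-injective) hub is-hub?)
      renaming (size to r'; elt to stars)

    centre-in-B : ∀ u → ∃ λ p' → f (centre (stars u)) ≡ vB i p'
    centre-in-B u = A-neighbour (root-adj root↦A (stars u)) (elt-sat u)

    leaf-in-A : ∀ u j → ∃ λ p' → f (leaf (stars u) j) ≡ vA i p'
    leaf-in-A u j = B-neighbour (centre-adj (proj₂ (centre-in-B u)) j)

    family : Fin (suc (r' * q)) → TV ℓ (suc q)
    family = root ∷ leaves q stars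

    lands : ∀ t → ∃ λ p' → f (family t) ≡ vA i p'
    lands zero    = p , root↦A
    lands (suc t) = leaf-in-A (proj₁ (remQuot {r'} q t)) (proj₂ (remQuot {r'} q t))

    A-overfull : (ℓ ∸ 1) * q < a
    A-overfull = begin-strict
      (ℓ ∸ 1) * q ≤⟨ *-monoˡ-≤ q (∸-monoˡ-≤ 1 nearly-n) ⟩
      r' * q      <⟨ n<1+n _ ⟩
      suc (r' * q) ≤⟨ count-into (vA i) (f ∘ family)
                        (image-injective family
                          (cons-injective root _ (leaves-injective q stars elt-inj) (λ t ())))
                        lands ⟩
      a           ∎

  module RootInB (i : Fin 2) (p : Fin b) (root↦B : f root ≡ vB i p) where
    all-leaves : Fin (ℓ * q) → TV ℓ (suc q)
    all-leaves = leaves q id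

    open AllButOne (avoid-point (f ∘ all-leaves) (image-injective _ (leaves-injective q id id)) hub is-hub?)
      renaming (size to r'; elt to picked)

    leaf-in-B : ∀ u → ∃ λ p' → f (all-leaves (picked u)) ≡ vB i p'
    leaf-in-B u = A-neighbour (centre-adj (proj₂ (B-neighbour (root-adj root↦B s))) j) (elt-sat u)
      where
      s : Fin ℓ
      s = proj₁ (remQuot {ℓ} q (picked u))
      j : Fin q
      j = proj₂ (remQuot {ℓ} q (picked u))

    family : Fin (suc r') → TV ℓ (suc q)
    family = root ∷ (all-leaves ∘ picked)

    lands : ∀ t → ∃ λ p' → f (family t) ≡ vB i p'
    lands zero    = p , root↦B
    lands (suc u) = leaf-in-B u

    B-overfull : ℓ * q ≤ b
    B-overfull = ≤-trans nearly-n
      (count-into (vB i) (f ∘ family)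
        (image-injective family
          (cons-injective root _ (elt-inj ∘ leaves-injective q id id) (λ t ())))
        lands)

  outcome : Outcome ℓ q a b
  outcome with f root in eq
  ... | hub    = inj₁ (RootOnHub.split eq)
  ... | vA i p = inj₂ (inj₁ (RootInA.A-overfull i p eq))
  ... | vB i p = inj₂ (inj₂ (RootInB.B-overfull i p eq))

embedding-forces : ∀ {ℓ q a b} → T ℓ (suc q) ⊆G Hgraph a b → Outcome ℓ q a b
embedding-forces (f , f-inj , f-adj) = Embedding.outcome f f-inj f-adj

odd-split : ∀ ℓ r r' → r + r' ≡ ℓ → ¬ (2 ∣ ℓ) → ℓ + 1 ≤ 2 * r ⊎ ℓ + 1 ≤ 2 * r'
odd-split ℓ r r' sum odd with ℓ + 1 ≤? 2 * r
... | yes big = inj₁ big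
... | no ¬big = inj₂ (+-cancelˡ-≤ (2 * r) _ _ (begin
    2 * r + (ℓ + 1)     ≡⟨ shuffle r ℓ ⟩
    suc (2 * r) + ℓ     ≤⟨ +-monoˡ-≤ ℓ 2r<ℓ ⟩
    ℓ + ℓ               ≡⟨ cong (λ n → n + n) (sym sum) ⟩
    (r + r') + (r + r') ≡⟨ double r r' ⟩
    2 * r + 2 * r'      ∎))
  where
  shuffle : ∀ r ℓ → 2 * r + (ℓ + 1) ≡ suc (2 * r) + ℓ
  shuffle = solve-∀
  double : ∀ r r' → (r + r') + (r + r') ≡ 2 * r + 2 * r'
  double = solve-∀
  2r≢ℓ : 2 * r ≢ ℓ
  2r≢ℓ eq = odd (divides r (trans (sym eq) (*-comm 2 r)))
  2r<ℓ : 2 * r < ℓ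
  2r<ℓ = ≤∧≢⇒< (m<1+n⇒m≤n (subst (2 * r <_) (+-comm ℓ 1) (≰⇒> ¬big))) 2r≢ℓ

majority-bound : ∀ ℓ q b s → ℓ + 1 ≤ 2 * s → s * q ≤ b → (ℓ + 1) * q ≤ 2 * b
majority-bound ℓ q b s big fits = begin
  (ℓ + 1) * q ≤⟨ *-monoˡ-≤ q big ⟩
  2 * s * q   ≡⟨ *-assoc 2 s q ⟩
  2 * (s * q) ≤⟨ *-monoʳ-≤ 2 fits ⟩
  2 * b       ∎

larger-side : ∀ ℓ q b r r' → r + r' ≡ ℓ → ¬ (2 ∣ ℓ) → r * q ≤ b → r' * q ≤ b →
              (ℓ + 1) * q ≤ 2 * b
larger-side ℓ q b r r' sum odd fits fits' with odd-split ℓ r r' sum odd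
... | inj₁ big = majority-bound ℓ q b r big fits
... | inj₂ big = majority-bound ℓ q b r' big fits'

halves≤ : ∀ x y → 2 * (x / 2 + y / 2) ≤ x + y
halves≤ x y = begin
  2 * (x / 2 + y / 2)     ≡⟨ distrib (x / 2) (y / 2) ⟩
  x / 2 * 2 + y / 2 * 2   ≤⟨ +-mono-≤ (m/n*n≤m x 2) (m/n*n≤m y 2) ⟩
  x + y                   ∎
  where
  distrib : ∀ u w → 2 * (u + w) ≡ u * 2 + w * 2
  distrib = solve-∀

double-pred< : ∀ S N → 2 * S ≤ N → 0 < N → 2 * (S ∸ 1) < N
double-pred< zero    N _  N>0 = N>0
double-pred< (suc S) N le _   = <-≤-trans (*-monoʳ-< 2 (n<1+n S)) le

sizeB-bound : ∀ ℓ q c → 1 ≤ ℓ → 1 ≤ c → c * (ℓ * (ℓ + 1)) ≤ ℓ * suc q →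
              2 * sizeB (ℓ * suc q) ℓ c < (ℓ + 1) * q
sizeB-bound ℓ@(suc _) q c@(suc c') _ _ hyp =
  double-pred< (k / 2 + Z / 2) ((ℓ + 1) * q) double-sum≤ (≤-trans q-positive (m≤m+n q _))
  where
  k Z : ℕ
  k = ℓ * suc q
  Z = c' * (ℓ + 1)
  expand : ∀ c' ℓ → suc c' * (ℓ * (ℓ + 1)) ≡ ℓ * suc (ℓ + c' * (ℓ + 1))
  expand = solve-∀
  regroup : ∀ ℓ q Z → ℓ * suc q + Z ≡ ℓ * q + (ℓ + Z)
  regroup = solve-∀
  collect : ∀ ℓ q → ℓ * q + q ≡ (ℓ + 1) * q
  collect = solve-∀
  -- c (ℓ + 1) ≤ q + 1, i.e. ℓ + (c - 1)(ℓ + 1) ≤ q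
  room : ℓ + Z ≤ q
  room = s≤s⁻¹ (*-cancelˡ-≤ ℓ (subst (_≤ k) (expand c' ℓ) hyp))
  q-positive : 1 ≤ q
  q-positive = ≤-trans (s≤s z≤n) (≤-trans (m≤m+n ℓ Z) room)
  double-sum≤ : 2 * (k / 2 + Z / 2) ≤ (ℓ + 1) * q
  double-sum≤ = begin
    2 * (k / 2 + Z / 2) ≤⟨ halves≤ k Z ⟩
    k + Z               ≡⟨ regroup ℓ q Z ⟩
    ℓ * q + (ℓ + Z)     ≤⟨ +-monoʳ-≤ (ℓ * q) room ⟩
    ℓ * q + q           ≡⟨ collect ℓ q ⟩
    (ℓ + 1) * q         ∎

succ-times≤double : ∀ ℓ q → 1 ≤ ℓ → (ℓ + 1) * q ≤ 2 * (ℓ * q)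
succ-times≤double ℓ q ℓ≥1 = begin
  (ℓ + 1) * q ≤⟨ *-monoˡ-≤ q (+-monoʳ-≤ ℓ (≤-trans ℓ≥1 (m≤m+n ℓ 0))) ⟩
  2 * ℓ * q   ≡⟨ *-assoc 2 ℓ q ⟩
  2 * (ℓ * q) ∎

no-empty-stars : ∀ ℓ c → 1 ≤ ℓ → 1 ≤ c → ¬ (c * (ℓ * (ℓ + 1)) ≤ ℓ * 0)
no-empty-stars ℓ@(suc _) c@(suc _) _ _ hyp =
  <⇒≱ (≤-trans (s≤s z≤n) hyp) (≤-reflexive (*-zeroʳ ℓ))

lemma2p2 : (k ℓ c m : ℕ) → k ≡ ℓ * m → 1 ≤ c → c * (ℓ * (ℓ + 1)) ≤ k →
           3 ≤ ℓ → ¬ (2 ∣ ℓ) → ¬ (T ℓ m ⊆G H k ℓ c m)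
lemma2p2 .(ℓ * zero) ℓ c zero refl c≥1 hyp ℓ≥3 odd _ =
  no-empty-stars ℓ c (≤-trans (s≤s z≤n) ℓ≥3) c≥1 hyp
lemma2p2 .(ℓ * suc q) ℓ c (suc q) refl c≥1 hyp ℓ≥3 odd T⊆H =
  [ split-fails , [ A-fails , B-fails ] ] (embedding-forces T⊆H)
  where
  ℓ≥1 : 1 ≤ ℓ
  ℓ≥1 = ≤-trans (s≤s z≤n) ℓ≥3
  b : ℕ
  b = sizeB (ℓ * suc q) ℓ c
  B-small : 2 * b < (ℓ + 1) * q
  B-small = sizeB-bound ℓ q c ℓ≥1 c≥1 hyp
  split-fails : ¬ (∃₂ λ r r' → r + r' ≡ ℓ × r * q ≤ b × r' * q ≤ b)
  split-fails (r , r' , sum , fits , fits') = <⇒≱ B-small (larger-side ℓ q b r r' sum odd fits fits')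
  A-fails : ¬ ((ℓ ∸ 1) * q < sizeA ℓ (suc q))
  A-fails = <-irrefl refl
  B-fails : ¬ (ℓ * q ≤ b)
  B-fails fits = <⇒≱ B-small (≤-trans (succ-times≤double ℓ q ℓ≥1) (*-monoʳ-≤ 2 fits))
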